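{- Let $I$ be an abelian ideal in $\Phi^+$, let $\beta_1,\beta_2,\gamma_1,\gamma_2\in I$ with $\beta_1+\beta_2=\gamma_1+\gamma_2$ and $\beta_1<\gamma_i<\beta_2$ for $i=1,2$ ($\gamma_1=\gamma_2$ allowed), and set $x=\beta_2-\gamma_1$, $y=\beta_2-\gamma_2$ (these are roots). (1) If $x$ is long, then $y,\beta_1,\beta_2,\gamma_1,\gamma_2$ are also long. (2) If any of $x,y,\beta_1,\beta_2,\gamma_1,\gamma_2$ is short, then $x$ and $y$ are short and at most one of $\beta_1,\beta_2,\gamma_1,\gamma_2$ is long, except when $\gamma_1=\gamma_2$, in which case $\gamma_1$ is short and $\beta_1,\beta_2$ are long.
   Context: $\Phi$ is an irreducible crystallographic root system, $\Phi^+$ a positive system with simple system $\Pi$. The standard partial order: $x\le y$ iff $y-x$ is a nonnegative integer combination of $\Pi$; $x<y$ means $x\le y$, $x\neq y$. An abelian ideal of $\Phi^+$ is a subset $I\subseteq\Phi^+$ such that $\beta\in I$, $\gamma\in\Phi^+$, $\beta\le\gamma$ imply $\gamma\in I$, and $\beta+\gamma\notin\Phi$ for all $\beta,\gamma\in I$. Short/long refers to root lengths; if all roots have the same length, all are considered long. -}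

module Defs where

open import Data.Nat using (ℕ)
open import Data.Integer using (ℤ; _+_; _*_; _-_; -_; _≤_; _<_; 0ℤ; 1ℤ; +_)
open import Data.Fin using (Fin; _≟_)
open import Data.Vec using (Vec; lookup; zipWith; map; tabulate; foldr; replicate)
open import Data.List using (List)
open import Data.List.Membership.Propositional using (_∈_; _∉_)
open import Data.Bool using (Bool; true; false; if_then_else_)
open import Data.Product using (Σ; _×_)
open import Data.Sum using (_⊎_)
open import Relation.Nullary using (¬_)
open import Relation.Nullary.Decidable using (⌊_⌋)
open import Relation.Binary.PropositionalEquality using (_≡_; _≢_)

-- Vectors in ℤ^n are coordinates with respect to the simple system Π.
Vecℤ : ℕ → Set
Vecℤ n = Vec ℤ n

_+ᵛ_ : ∀ {n} → Vecℤ n → Vecℤ n → Vecℤ n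
_+ᵛ_ = zipWith _+_

_-ᵛ_ : ∀ {n} → Vecℤ n → Vecℤ n → Vecℤ n
_-ᵛ_ = zipWith _-_

negᵛ : ∀ {n} → Vecℤ n → Vecℤ n
negᵛ = map (λ a → - a)

_·ᵛ_ : ∀ {n} → ℤ → Vecℤ n → Vecℤ n
a ·ᵛ v = map (a *_) v

0ᵛ : ∀ {n} → Vecℤ n
0ᵛ {n} = replicate n 0ℤ

e : ∀ {n} → Fin n → Vecℤ n
e i = tabulate λ j → if ⌊ i ≟ j ⌋ then 1ℤ else 0ℤ

sumᵛ : ∀ {n} → Vecℤ n → ℤ
sumᵛ = foldr _ _+_ 0ℤ

bil : ∀ {n} → (Fin n → Fin n → ℤ) → Vecℤ n → Vecℤ n → ℤ
bil G u v = sumᵛ (tabulate λ i → sumᵛ (tabulate λ j → lookup u i * G i j * lookup v j))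

NonNeg : ∀ {n} → Vecℤ n → Set
NonNeg v = ∀ i → 0ℤ ≤ lookup v i

NonPos : ∀ {n} → Vecℤ n → Set
NonPos v = ∀ i → lookup v i ≤ 0ℤ

-- The (positive definite,
-- symmetric) inner product is given by its Gram matrix G on Π, scaled to be
-- integral (always possible; only ratios of inner products matter).
record RootSystem (n : ℕ) : Set where
  field
    G         : Fin n → Fin n → ℤ
    G-sym     : ∀ i j → G i j ≡ G j i
    G-posdef  : ∀ (v : Vecℤ n) → v ≢ 0ᵛ → 0ℤ < bil G v v
    Φ         : List (Vecℤ n)
    zero∉Φ    : 0ᵛ ∉ Φ
    simple∈Φ  : ∀ i → e i ∈ Φ
    signed    : ∀ α → α ∈ Φ → NonNeg α ⊎ NonPos α
    reduced   : ∀ α β → α ∈ Φ → β ∈ Φ → ∀ (a b : ℤ) → a ≢ 0ℤ → b ≢ 0ℤ →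
                a ·ᵛ α ≡ b ·ᵛ β → (β ≡ α) ⊎ (β ≡ negᵛ α)
    cryst     : ∀ α β → α ∈ Φ → β ∈ Φ →
                Σ ℤ λ k → ((+ 2) * bil G α β ≡ k * bil G β β) × ((α -ᵛ (k ·ᵛ β)) ∈ Φ)

module _ {n : ℕ} (R : RootSystem n) where
  open RootSystem R

  ⟨_,_⟩ : Vecℤ n → Vecℤ n → ℤ
  ⟨ u , v ⟩ = bil G u v

  Irreducible : Set
  Irreducible = ¬ (Σ (Vecℤ n → Bool) λ P →
                    (Σ (Vecℤ n) λ α → α ∈ Φ × P α ≡ true) ×
                    (Σ (Vecℤ n) λ β → β ∈ Φ × P β ≡ false) ×
                    (∀ α β → α ∈ Φ → β ∈ Φ → P α ≡ true → P β ≡ false → ⟨ α , β ⟩ ≡ 0ℤ))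

  Positive : Vecℤ n → Set
  Positive α = α ∈ Φ × NonNeg α

  _≼_ : Vecℤ n → Vecℤ n → Set
  x ≼ y = NonNeg (y -ᵛ x)

  _≺_ : Vecℤ n → Vecℤ n → Set
  x ≺ y = x ≼ y × x ≢ y

  record AbelianIdeal (I : Vecℤ n → Set) : Set where
    field
      ⊆Φ⁺     : ∀ β → I β → Positive β
      upward  : ∀ β γ → I β → Positive γ → β ≼ γ → I γ
      abelian : ∀ β γ → I β → I γ → (β +ᵛ γ) ∉ Φ

  Long : Vecℤ n → Set
  Long α = ∀ β → β ∈ Φ → ⟨ β , β ⟩ ≤ ⟨ α , α ⟩

  Short : Vecℤ n → Set
  Short α = ¬ Long α

  AtMostOneLong : Vec (Vecℤ n) 4 → Set
  AtMostOneLong v = ∀ i j → Long (lookup v i) → Long (lookup v j) → i ≡ j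

-- Two roots u ≠ v with ⟪u,v⟫ > 0 have Cartan integers 2⟪u,v⟫/∥v∥² and 2⟪u,v⟫/∥u∥² that are
-- positive with product < 4 (Cauchy–Schwarz); so u − v is a root, the longer of u, v has squared
-- length 2⟪u,v⟫, hence ∥u − v∥² = min (∥u∥², ∥v∥²), and unequal lengths have ratio 2 or 3.
-- Inside an abelian ideal all pairings are ≥ 0, and the cross pairings ⟪βᵢ,γⱼ⟫ are even > 0.
-- Thus x = β₂ − γ₁ = γ₂ − β₁ has ∥x∥² = min (∥β₂∥², ∥γ₁∥²) = min (∥β₁∥², ∥γ₂∥²), which gives (1).
-- For (2), irreducibility leaves only two root lengths, with ratio 2 or 3, and comparing
-- ∥β₁ + β₂∥² = ∥γ₁ + γ₂∥² rules out two long roots among β₁, β₂ (and among γ₁, γ₂); a long pair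
-- (βᵢ, γⱼ) would make x or y long. If γ₁ = γ₂ = γ then ∥γ∥² < ∥β₁∥², since otherwise
-- 2⟪β₂,γ⟫ = 3∥γ∥² and β₂ − 3γ = −(β₁ + γ) would be a root.

module Submission where

open import Defs
open import Data.Nat using (ℕ; zero; suc; z≤n; s≤s)
import Data.Nat.Properties as ℕ
open import Data.Integer
  using (ℤ; +_; -[1+_]; 0ℤ; 1ℤ; _+_; _-_; _*_; -_; _≤_; _<_; +<+; nonNegative; positive; >-nonZero)
import Data.Integer.Properties as ℤ
open import Data.Integer.Tactic.RingSolver using (solve-∀)
open import Data.Fin using (Fin; zero; suc)
open import Data.Fin.Patterns using (0F; 1F; 2F; 3F)
open import Data.Vec using ([]; _∷_; lookup; tabulate)
open import Data.Vec.Properties using (lookup-map; lookup-zipWith; ∷-injectiveˡ; ∷-injectiveʳ)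
import Data.Vec.Properties
open import Data.List.Membership.Propositional using (_∈_; _∉_; find; lose)
open import Data.List.Relation.Unary.Any using (Any; any?)
open import Data.Bool using (true; false)
open import Data.Product using (Σ; _×_; _,_; proj₁; proj₂)
open import Data.Sum using (_⊎_; inj₁; inj₂; [_,_])
open import Data.Empty using (⊥; ⊥-elim)
open import Function using (_∘_)
open import Relation.Nullary using (Dec; does; yes; no; ¬?; _×-dec_)
open import Relation.Nullary.Decidable using (dec-true; dec-false)
open import Relation.Binary using (tri<; tri≈; tri>)
open import Relation.Binary.PropositionalEquality

private variable
  n : ℕ
  x y k k′ w M U V : ℤ

x≤x+y : 0ℤ ≤ y → x ≤ x + y
x≤x+y {y} {x} 0≤y = ℤ.i≤i+j x y {{nonNegative 0≤y}}

*-monoʳ-≤ : 0ℤ < V → x ≤ y → x * V ≤ y * V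
*-monoʳ-≤ {V} 0<V = ℤ.*-monoʳ-≤-nonNeg V {{nonNegative (ℤ.<⇒≤ 0<V)}}

x≤k*x : 1ℤ ≤ k → 0ℤ < x → x ≤ k * x
x≤k*x {k} {x} 1≤k 0<x = subst (_≤ k * x) (ℤ.*-identityˡ x) (*-monoʳ-≤ 0<x 1≤k)

≡-*-unit : x ≡ k * y → k ≡ 1ℤ → x ≡ y
≡-*-unit x≡ky refl = trans x≡ky (ℤ.*-identityˡ _)

*-pos : 0ℤ < x → 0ℤ < y → 0ℤ < x * y
*-pos {x} {y} 0<x 0<y = ℤ.*-monoʳ-<-pos y {{positive 0<y}} 0<x

0<j-i⇒i<j : 0ℤ < y - x → x < y
0<j-i⇒i<j {y} {x} 0<y-x = subst₂ _<_ (ℤ.+-identityˡ x) (cancel x y) (ℤ.+-monoˡ-< x 0<y-x)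
  where cancel : ∀ x y → y - x + x ≡ y
        cancel = solve-∀

pos-factor : 0ℤ < x → 0ℤ < x * y → 0ℤ < y
pos-factor {x} {y} 0<x 0<xy =
  ℤ.*-cancelˡ-<-nonNeg x {{nonNegative (ℤ.<⇒≤ 0<x)}} (subst (_< x * y) (sym (ℤ.*-zeroʳ x)) 0<xy)

x<2x : 0ℤ < x → x < + 2 * x
x<2x {x} 0<x = subst₂ _<_ (ℤ.+-identityʳ x) (sym (double x)) (ℤ.+-monoʳ-< x 0<x)
  where double : ∀ x → + 2 * x ≡ x + x
        double = solve-∀

3x<4x : 0ℤ < x → + 3 * x < + 4 * x
3x<4x {x} 0<x = ℤ.*-monoʳ-<-pos x {{positive 0<x}} (+<+ (ℕ.n<1+n 3))

cartan-positive : 0ℤ < V → 0ℤ < w → + 2 * w ≡ k * V → 1ℤ ≤ k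
cartan-positive {V} {w} {k} 0<V 0<w 2w≡kV with k ℤ.≤? 0ℤ
... | no k≰0 = ℤ.i<j⇒suc[i]≤j (ℤ.≰⇒> k≰0)
... | yes k≤0 =
  ⊥-elim (ℤ.<⇒≱ (ℤ.*-monoˡ-<-pos (+ 2) 0<w) (subst (_≤ 0ℤ) (sym 2w≡kV) (*-monoʳ-≤ 0<V k≤0)))

cartan-product<4 : 0ℤ < U → 0ℤ < V → + 2 * w ≡ k * V → + 2 * w ≡ k′ * U →
                   w * w < U * V → k * k′ < + 4
cartan-product<4 {U} {V} {w} {k} {k′} 0<U 0<V 2w≡kV 2w≡k′U w²<UV =
  ℤ.*-cancelʳ-<-nonNeg (U * V) {{nonNegative (ℤ.<⇒≤ (*-pos 0<U 0<V))}}
    (subst (_< + 4 * (U * V)) kk′UV≡4w² (ℤ.*-monoˡ-<-pos (+ 4) w²<UV))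
  where
  kk′UV≡4w² : + 4 * (w * w) ≡ k * k′ * (U * V)
  kk′UV≡4w² = begin
    + 4 * (w * w)             ≡⟨ square-double w ⟩
    (+ 2 * w) * (+ 2 * w)     ≡⟨ cong₂ _*_ 2w≡kV 2w≡k′U ⟩
    (k * V) * (k′ * U)        ≡⟨ rearrange k V k′ U ⟩
    k * k′ * (U * V)          ∎
    where
    open ≡-Reasoning
    square-double : ∀ w → + 4 * (w * w) ≡ (+ 2 * w) * (+ 2 * w)
    square-double = solve-∀
    rearrange : ∀ k V k′ U → (k * V) * (k′ * U) ≡ k * k′ * (U * V)
    rearrange = solve-∀

one-cartan-integer≡1 : 1ℤ ≤ k → 1ℤ ≤ k′ → k * k′ < + 4 → k ≡ 1ℤ ⊎ k′ ≡ 1ℤ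
one-cartan-integer≡1 {k} {k′} 1≤k 1≤k′ kk′<4 with k ℤ.≤? 1ℤ | k′ ℤ.≤? 1ℤ
... | yes k≤1 | _ = inj₁ (ℤ.≤-antisym k≤1 1≤k)
... | no _ | yes k′≤1 = inj₂ (ℤ.≤-antisym k′≤1 1≤k′)
... | no k≰1 | no k′≰1 = ⊥-elim (ℤ.<⇒≱ kk′<4 (ℤ.≤-trans 4≤2k′ 2k′≤kk′))
  where
  2≤k : + 2 ≤ k
  2≤k = ℤ.i<j⇒suc[i]≤j (ℤ.≰⇒> k≰1)
  2≤k′ : + 2 ≤ k′
  2≤k′ = ℤ.i<j⇒suc[i]≤j (ℤ.≰⇒> k′≰1)
  4≤2k′ : + 4 ≤ + 2 * k′
  4≤2k′ = ℤ.*-monoˡ-≤-nonNeg (+ 2) 2≤k′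
  2k′≤kk′ : + 2 * k′ ≤ k * k′
  2k′≤kk′ = *-monoʳ-≤ (ℤ.<-≤-trans (+<+ (s≤s z≤n)) 2≤k′) 2≤k

record AcuteNorms (U V w : ℤ) : Set where
  field
    ≤⇒2w≡V    : U ≤ V → + 2 * w ≡ V
    ≥⇒2w≡U    : V ≤ U → + 2 * w ≡ U
    <⇒2U≤V≤3U : U < V → + 2 * U ≤ V × V ≤ + 3 * U

norms-when-2w≡V : 0ℤ < U → + 2 * w ≡ V → + 2 * w ≡ k′ * U → 1ℤ ≤ k′ → k′ ≤ + 3 →
                  AcuteNorms U V w
norms-when-2w≡V {U} {w} {V} {k′} 0<U 2w≡V 2w≡k′U 1≤k′ k′≤3 = record
  { ≤⇒2w≡V    = λ _ → 2w≡V
  ; ≥⇒2w≡U    = λ V≤U → trans 2w≡V (ℤ.≤-antisym V≤U U≤V)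
  ; <⇒2U≤V≤3U = λ U<V → subst (+ 2 * U ≤_) k′U≡V (*-monoʳ-≤ 0<U (2≤k′ U<V))
                      , subst (_≤ + 3 * U) k′U≡V (*-monoʳ-≤ 0<U k′≤3)
  }
  where
  k′U≡V : k′ * U ≡ V
  k′U≡V = trans (sym 2w≡k′U) 2w≡V
  U≤V : U ≤ V
  U≤V = subst (U ≤_) k′U≡V (x≤k*x 1≤k′ 0<U)
  2≤k′ : U < V → + 2 ≤ k′
  2≤k′ U<V with k′ ℤ.≤? 1ℤ
  ... | no k′≰1 = ℤ.i<j⇒suc[i]≤j (ℤ.≰⇒> k′≰1)
  ... | yes k′≤1 = ⊥-elim (ℤ.<-irrefl U≡V U<V)
    where
    U≡V : U ≡ V
    U≡V = trans (sym (ℤ.*-identityˡ U)) (trans (cong (_* U) (ℤ.≤-antisym 1≤k′ k′≤1)) k′U≡V)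

norms-when-2w≡U : 0ℤ < V → + 2 * w ≡ U → + 2 * w ≡ k * V → 1ℤ ≤ k → AcuteNorms U V w
norms-when-2w≡U {V} {w} {U} {k} 0<V 2w≡U 2w≡kV 1≤k = record
  { ≤⇒2w≡V    = λ U≤V → trans 2w≡U (ℤ.≤-antisym U≤V V≤U)
  ; ≥⇒2w≡U    = λ _ → 2w≡U
  ; <⇒2U≤V≤3U = λ U<V → ⊥-elim (ℤ.<⇒≱ U<V V≤U)
  }
  where
  V≤U : V ≤ U
  V≤U = subst (V ≤_) (trans (sym 2w≡kV) 2w≡U) (x≤k*x 1≤k 0<V)

acute-norms-of-cartan : 0ℤ < U → 0ℤ < V → 0ℤ < w → + 2 * w ≡ k * V → + 2 * w ≡ k′ * U →
                        w * w < U * V → AcuteNorms U V w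
acute-norms-of-cartan {U} {V} {w} {k} {k′} 0<U 0<V 0<w 2w≡kV 2w≡k′U w²<UV =
  norms (one-cartan-integer≡1 1≤k 1≤k′ kk′<4)
  where
  1≤k : 1ℤ ≤ k
  1≤k = cartan-positive {k = k} 0<V 0<w 2w≡kV
  1≤k′ : 1ℤ ≤ k′
  1≤k′ = cartan-positive {k = k′} 0<U 0<w 2w≡k′U
  kk′<4 : k * k′ < + 4
  kk′<4 = cartan-product<4 {k = k} {k′ = k′} 0<U 0<V 2w≡kV 2w≡k′U w²<UV
  norms : k ≡ 1ℤ ⊎ k′ ≡ 1ℤ → AcuteNorms U V w
  norms (inj₁ k≡1) = norms-when-2w≡V 0<U (≡-*-unit 2w≡kV k≡1) 2w≡k′U 1≤k′
    (ℤ.i<j⇒i≤pred[j] (subst (_< + 4) (≡-*-unit refl k≡1) kk′<4))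
  norms (inj₂ k′≡1) = norms-when-2w≡U 0<V (≡-*-unit 2w≡k′U k′≡1) 2w≡kV 1≤k

U-2w+V≡U : AcuteNorms U V w → U ≤ V → U - + 2 * w + V ≡ U
U-2w+V≡U {U} {V} norms U≤V = trans (cong (λ t → U - t + V) (AcuteNorms.≤⇒2w≡V norms U≤V)) (cancel U V)
  where cancel : ∀ U V → U - V + V ≡ U
        cancel = solve-∀

U-2w+V≡V : AcuteNorms U V w → V ≤ U → U - + 2 * w + V ≡ V
U-2w+V≡V {U} {V} norms V≤U = trans (cong (λ t → U - t + V) (AcuteNorms.≥⇒2w≡U norms V≤U)) (cancel U V)
  where cancel : ∀ U V → U - U + V ≡ V
        cancel = solve-∀

∑ : ∀ {n} → (Fin n → ℤ) → ℤ
∑ f = sumᵛ (tabulate f)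

∑-cong : ∀ {n} {f g : Fin n → ℤ} → (∀ i → f i ≡ g i) → ∑ f ≡ ∑ g
∑-cong {zero}  f≗g = refl
∑-cong {suc n} f≗g = cong₂ _+_ (f≗g zero) (∑-cong (f≗g ∘ suc))

∑-zero : ∀ n → ∑ {n} (λ _ → 0ℤ) ≡ 0ℤ
∑-zero zero    = refl
∑-zero (suc n) = cong (_+_ 0ℤ) (∑-zero n)

∑-distrib-+ : ∀ {n} (f g : Fin n → ℤ) → ∑ (λ i → f i + g i) ≡ ∑ f + ∑ g
∑-distrib-+ {zero}  f g = refl
∑-distrib-+ {suc n} f g = trans (cong (_+_ (f zero + g zero)) (∑-distrib-+ (f ∘ suc) (g ∘ suc)))
                                (interchange (f zero) (g zero) (∑ (f ∘ suc)) (∑ (g ∘ suc)))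
  where interchange : ∀ a b c d → (a + b) + (c + d) ≡ (a + c) + (b + d)
        interchange = solve-∀

∑-distribˡ-* : ∀ {n} k (f : Fin n → ℤ) → ∑ (λ i → k * f i) ≡ k * ∑ f
∑-distribˡ-* {zero}  k f = sym (ℤ.*-zeroʳ k)
∑-distribˡ-* {suc n} k f = trans (cong (_+_ (k * f zero)) (∑-distribˡ-* k (f ∘ suc)))
                                 (distrib k (f zero) (∑ (f ∘ suc)))
  where distrib : ∀ k a b → k * a + k * b ≡ k * (a + b)
        distrib = solve-∀

∑-neg : ∀ {n} (f : Fin n → ℤ) → ∑ (λ i → - f i) ≡ - ∑ f
∑-neg {zero}  f = refl
∑-neg {suc n} f = trans (cong (_+_ (- f zero)) (∑-neg (f ∘ suc))) (neg-distrib (f zero) (∑ (f ∘ suc)))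
  where neg-distrib : ∀ a b → - a + - b ≡ - (a + b)
        neg-distrib = solve-∀

∑-comm : ∀ {m n} (f : Fin m → Fin n → ℤ) → ∑ (λ i → ∑ (f i)) ≡ ∑ (λ j → ∑ (λ i → f i j))
∑-comm {zero}  {n} f = sym (∑-zero n)
∑-comm {suc m} f = trans (cong (_+_ (∑ (f zero))) (∑-comm (f ∘ suc)))
                         (sym (∑-distrib-+ (f zero) (λ j → ∑ (λ i → f (suc i) j))))

module BilinearForm {n : ℕ} (G : Fin n → Fin n → ℤ) (G-sym : ∀ i j → G i j ≡ G j i) where

  ⟪_,_⟫ : Vecℤ n → Vecℤ n → ℤ
  ⟪_,_⟫ = bil G

  ∥_∥² : Vecℤ n → ℤ
  ∥ u ∥² = ⟪ u , u ⟫

  private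
    term : Vecℤ n → Vecℤ n → Fin n → Fin n → ℤ
    term u w i j = lookup u i * G i j * lookup w j

    ∑∑ : (Fin n → Fin n → ℤ) → ℤ
    ∑∑ f = ∑ λ i → ∑ (f i)

    ∑∑-cong : ∀ {f g} → (∀ i j → f i j ≡ g i j) → ∑∑ f ≡ ∑∑ g
    ∑∑-cong f≗g = ∑-cong λ i → ∑-cong (f≗g i)

    ∑∑-distrib-+ : ∀ f g → ∑∑ (λ i j → f i j + g i j) ≡ ∑∑ f + ∑∑ g
    ∑∑-distrib-+ f g = trans (∑-cong λ i → ∑-distrib-+ (f i) (g i)) (∑-distrib-+ (λ i → ∑ (f i)) (λ i → ∑ (g i)))

    ∑∑-distribˡ-* : ∀ k f → ∑∑ (λ i j → k * f i j) ≡ k * ∑∑ f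
    ∑∑-distribˡ-* k f = trans (∑-cong λ i → ∑-distribˡ-* k (f i)) (∑-distribˡ-* k (λ i → ∑ (f i)))

    ∑∑-neg : ∀ f → ∑∑ (λ i j → - f i j) ≡ - ∑∑ f
    ∑∑-neg f = trans (∑-cong λ i → ∑-neg (f i)) (∑-neg (λ i → ∑ (f i)))

  ⟪⟫-sym : ∀ u v → ⟪ u , v ⟫ ≡ ⟪ v , u ⟫
  ⟪⟫-sym u v = trans (∑-comm (term u v)) (∑∑-cong λ j i →
    trans (cong (λ g → lookup u i * g * lookup v j) (G-sym i j)) (swap (lookup u i) (G j i) (lookup v j)))
    where swap : ∀ a g b → a * g * b ≡ b * g * a
          swap = solve-∀

  ⟪+ᵛ⟫ˡ : ∀ u v w → ⟪ u +ᵛ v , w ⟫ ≡ ⟪ u , w ⟫ + ⟪ v , w ⟫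
  ⟪+ᵛ⟫ˡ u v w = trans (∑∑-cong λ i j →
      trans (cong (λ t → t * G i j * lookup w j) (lookup-zipWith _+_ i u v))
        (distrib (lookup u i) (lookup v i) (G i j) (lookup w j)))
    (∑∑-distrib-+ (term u w) (term v w))
    where distrib : ∀ a b g c → (a + b) * g * c ≡ a * g * c + b * g * c
          distrib = solve-∀

  ⟪-ᵛ⟫ˡ : ∀ u v w → ⟪ u -ᵛ v , w ⟫ ≡ ⟪ u , w ⟫ - ⟪ v , w ⟫
  ⟪-ᵛ⟫ˡ u v w = trans (∑∑-cong λ i j →
      trans (cong (λ t → t * G i j * lookup w j) (lookup-zipWith _-_ i u v))
        (distrib (lookup u i) (lookup v i) (G i j) (lookup w j)))
    (trans (∑∑-distrib-+ (term u w) (λ i j → - term v w i j)) (cong (_+_ ⟪ u , w ⟫) (∑∑-neg (term v w))))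
    where distrib : ∀ a b g c → (a - b) * g * c ≡ a * g * c + - (b * g * c)
          distrib = solve-∀

  ⟪·ᵛ⟫ˡ : ∀ k u w → ⟪ k ·ᵛ u , w ⟫ ≡ k * ⟪ u , w ⟫
  ⟪·ᵛ⟫ˡ k u w = trans (∑∑-cong λ i j →
      trans (cong (λ t → t * G i j * lookup w j) (lookup-map i (k *_) u))
        (assoc k (lookup u i) (G i j) (lookup w j)))
    (∑∑-distribˡ-* k (term u w))
    where assoc : ∀ k a g c → k * a * g * c ≡ k * (a * g * c)
          assoc = solve-∀

  ⟪negᵛ⟫ˡ : ∀ u w → ⟪ negᵛ u , w ⟫ ≡ - ⟪ u , w ⟫
  ⟪negᵛ⟫ˡ u w = trans (∑∑-cong λ i j →
      trans (cong (λ t → t * G i j * lookup w j) (lookup-map i -_ u))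
        (neg-assoc (lookup u i) (G i j) (lookup w j)))
    (∑∑-neg (term u w))
    where neg-assoc : ∀ a g c → - a * g * c ≡ - (a * g * c)
          neg-assoc = solve-∀

  ⟪+ᵛ⟫ʳ : ∀ u v w → ⟪ w , u +ᵛ v ⟫ ≡ ⟪ w , u ⟫ + ⟪ w , v ⟫
  ⟪+ᵛ⟫ʳ u v w = trans (⟪⟫-sym w (u +ᵛ v)) (trans (⟪+ᵛ⟫ˡ u v w) (cong₂ _+_ (⟪⟫-sym u w) (⟪⟫-sym v w)))

  ⟪-ᵛ⟫ʳ : ∀ u v w → ⟪ w , u -ᵛ v ⟫ ≡ ⟪ w , u ⟫ - ⟪ w , v ⟫
  ⟪-ᵛ⟫ʳ u v w = trans (⟪⟫-sym w (u -ᵛ v)) (trans (⟪-ᵛ⟫ˡ u v w) (cong₂ _-_ (⟪⟫-sym u w) (⟪⟫-sym v w)))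

  ⟪·ᵛ⟫ʳ : ∀ k u w → ⟪ w , k ·ᵛ u ⟫ ≡ k * ⟪ w , u ⟫
  ⟪·ᵛ⟫ʳ k u w = trans (⟪⟫-sym w (k ·ᵛ u)) (trans (⟪·ᵛ⟫ˡ k u w) (cong (k *_) (⟪⟫-sym u w)))

  ⟪negᵛ⟫ʳ : ∀ u w → ⟪ w , negᵛ u ⟫ ≡ - ⟪ w , u ⟫
  ⟪negᵛ⟫ʳ u w = trans (⟪⟫-sym w (negᵛ u)) (trans (⟪negᵛ⟫ˡ u w) (cong -_ (⟪⟫-sym u w)))

  ∥-ᵛ∥² : ∀ u v → ∥ u -ᵛ v ∥² ≡ ∥ u ∥² - + 2 * ⟪ u , v ⟫ + ∥ v ∥²
  ∥-ᵛ∥² u v = begin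
    ⟪ u -ᵛ v , u -ᵛ v ⟫                          ≡⟨ ⟪-ᵛ⟫ˡ u v (u -ᵛ v) ⟩
    ⟪ u , u -ᵛ v ⟫ - ⟪ v , u -ᵛ v ⟫                ≡⟨ cong₂ _-_ (⟪-ᵛ⟫ʳ u v u) (⟪-ᵛ⟫ʳ u v v) ⟩
    (∥ u ∥² - ⟪ u , v ⟫) - (⟪ v , u ⟫ - ∥ v ∥²)   ≡⟨ cong (λ t → ∥ u ∥² - ⟪ u , v ⟫ - (t - ∥ v ∥²)) (⟪⟫-sym v u) ⟩
    (∥ u ∥² - ⟪ u , v ⟫) - (⟪ u , v ⟫ - ∥ v ∥²)   ≡⟨ collect ∥ u ∥² ⟪ u , v ⟫ ∥ v ∥² ⟩
    ∥ u ∥² - + 2 * ⟪ u , v ⟫ + ∥ v ∥²               ∎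
    where open ≡-Reasoning
          collect : ∀ U w V → (U - w) - (w - V) ≡ U - + 2 * w + V
          collect = solve-∀

  ∥+ᵛ∥² : ∀ u v → ∥ u +ᵛ v ∥² ≡ ∥ u ∥² + + 2 * ⟪ u , v ⟫ + ∥ v ∥²
  ∥+ᵛ∥² u v = begin
    ⟪ u +ᵛ v , u +ᵛ v ⟫                          ≡⟨ ⟪+ᵛ⟫ˡ u v (u +ᵛ v) ⟩
    ⟪ u , u +ᵛ v ⟫ + ⟪ v , u +ᵛ v ⟫                ≡⟨ cong₂ _+_ (⟪+ᵛ⟫ʳ u v u) (⟪+ᵛ⟫ʳ u v v) ⟩
    (∥ u ∥² + ⟪ u , v ⟫) + (⟪ v , u ⟫ + ∥ v ∥²)   ≡⟨ cong (λ t → ∥ u ∥² + ⟪ u , v ⟫ + (t + ∥ v ∥²)) (⟪⟫-sym v u) ⟩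
    (∥ u ∥² + ⟪ u , v ⟫) + (⟪ u , v ⟫ + ∥ v ∥²)   ≡⟨ collect ∥ u ∥² ⟪ u , v ⟫ ∥ v ∥² ⟩
    ∥ u ∥² + + 2 * ⟪ u , v ⟫ + ∥ v ∥²               ∎
    where open ≡-Reasoning
          collect : ∀ U w V → (U + w) + (w + V) ≡ U + + 2 * w + V
          collect = solve-∀

  ∥negᵛ∥² : ∀ u → ∥ negᵛ u ∥² ≡ ∥ u ∥²
  ∥negᵛ∥² u = trans (⟪negᵛ⟫ˡ u (negᵛ u)) (trans (cong -_ (⟪negᵛ⟫ʳ u u)) (ℤ.neg-involutive ∥ u ∥²))

  ∥·ᵛ-·ᵛ∥² : ∀ p q u v → ∥ (p ·ᵛ u) -ᵛ (q ·ᵛ v) ∥² ≡ p * p * ∥ u ∥² - + 2 * p * q * ⟪ u , v ⟫ + q * q * ∥ v ∥²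
  ∥·ᵛ-·ᵛ∥² p q u v = begin
    ∥ (p ·ᵛ u) -ᵛ (q ·ᵛ v) ∥²                                            ≡⟨ ∥-ᵛ∥² (p ·ᵛ u) (q ·ᵛ v) ⟩
    ∥ p ·ᵛ u ∥² - + 2 * ⟪ p ·ᵛ u , q ·ᵛ v ⟫ + ∥ q ·ᵛ v ∥²               ≡⟨ cong₂ (λ s t → s - + 2 * t + ∥ q ·ᵛ v ∥²) (scale p p u u) (scale p q u v) ⟩
    p * (p * ∥ u ∥²) - + 2 * (p * (q * ⟪ u , v ⟫)) + ∥ q ·ᵛ v ∥²       ≡⟨ cong (λ t → p * (p * ∥ u ∥²) - + 2 * (p * (q * ⟪ u , v ⟫)) + t) (scale q q v v) ⟩
    p * (p * ∥ u ∥²) - + 2 * (p * (q * ⟪ u , v ⟫)) + q * (q * ∥ v ∥²)  ≡⟨ reassoc p q ∥ u ∥² ⟪ u , v ⟫ ∥ v ∥² ⟩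
    p * p * ∥ u ∥² - + 2 * p * q * ⟪ u , v ⟫ + q * q * ∥ v ∥²          ∎
    where
    open ≡-Reasoning
    scale : ∀ s r x y → ⟪ s ·ᵛ x , r ·ᵛ y ⟫ ≡ s * (r * ⟪ x , y ⟫)
    scale s r x y = trans (⟪·ᵛ⟫ˡ s x (r ·ᵛ y)) (cong (s *_) (⟪·ᵛ⟫ʳ r y x))
    reassoc : ∀ p q U w V → p * (p * U) - + 2 * (p * (q * w)) + q * (q * V) ≡ p * p * U - + 2 * p * q * w + q * q * V
    reassoc = solve-∀

  ∥reflection∥² : ∀ u v k → + 2 * ⟪ u , v ⟫ ≡ k * ∥ v ∥² → ∥ u -ᵛ (k ·ᵛ v) ∥² ≡ ∥ u ∥²
  ∥reflection∥² u v k 2w≡kV = begin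
    ∥ u -ᵛ (k ·ᵛ v) ∥²                                 ≡⟨ ∥-ᵛ∥² u (k ·ᵛ v) ⟩
    ∥ u ∥² - + 2 * ⟪ u , k ·ᵛ v ⟫ + ∥ k ·ᵛ v ∥²         ≡⟨ cong₂ (λ s t → ∥ u ∥² - + 2 * s + t) (⟪·ᵛ⟫ʳ k v u) kV·kV ⟩
    ∥ u ∥² - + 2 * (k * ⟪ u , v ⟫) + k * (k * ∥ v ∥²)    ≡⟨ regroup ∥ u ∥² ⟪ u , v ⟫ ∥ v ∥² k ⟩
    ∥ u ∥² - k * (+ 2 * ⟪ u , v ⟫) + k * (k * ∥ v ∥²)    ≡⟨ cong (λ t → ∥ u ∥² - k * t + k * (k * ∥ v ∥²)) 2w≡kV ⟩
    ∥ u ∥² - k * (k * ∥ v ∥²) + k * (k * ∥ v ∥²)         ≡⟨ cancel ∥ u ∥² (k * (k * ∥ v ∥²)) ⟩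
    ∥ u ∥²                                              ∎
    where
    open ≡-Reasoning
    kV·kV : ∥ k ·ᵛ v ∥² ≡ k * (k * ∥ v ∥²)
    kV·kV = trans (⟪·ᵛ⟫ˡ k v (k ·ᵛ v)) (cong (k *_) (⟪·ᵛ⟫ʳ k v v))
    regroup : ∀ U w V k → U - + 2 * (k * w) + k * (k * V) ≡ U - k * (+ 2 * w) + k * (k * V)
    regroup = solve-∀
    cancel : ∀ U x → U - x + x ≡ U
    cancel = solve-∀

u-[1·v]≡u-v : ∀ (u v : Vecℤ n) → u -ᵛ (1ℤ ·ᵛ v) ≡ u -ᵛ v
u-[1·v]≡u-v []      []      = refl
u-[1·v]≡u-v (x ∷ u) (y ∷ v) = cong₂ _∷_ (cong (_-_ x) (ℤ.*-identityˡ y)) (u-[1·v]≡u-v u v)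

u-[2·u]≡neg[u] : ∀ (u : Vecℤ n) → u -ᵛ ((+ 2) ·ᵛ u) ≡ negᵛ u
u-[2·u]≡neg[u] []      = refl
u-[2·u]≡neg[u] (x ∷ u) = cong₂ _∷_ (identity x) (u-[2·u]≡neg[u] u)
  where identity : ∀ x → x - + 2 * x ≡ - x
        identity = solve-∀

neg[v-u]≡u-v : ∀ (u v : Vecℤ n) → negᵛ (v -ᵛ u) ≡ u -ᵛ v
neg[v-u]≡u-v []      []      = refl
neg[v-u]≡u-v (x ∷ u) (y ∷ v) = cong₂ _∷_ (identity x y) (neg[v-u]≡u-v u v)
  where identity : ∀ x y → - (y - x) ≡ x - y
        identity = solve-∀

u-neg[v]≡u+v : ∀ (u v : Vecℤ n) → u -ᵛ negᵛ v ≡ u +ᵛ v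
u-neg[v]≡u+v []      []      = refl
u-neg[v]≡u+v (x ∷ u) (y ∷ v) = cong₂ _∷_ (cong (_+_ x) (ℤ.neg-involutive y)) (u-neg[v]≡u+v u v)

neg[neg[u]]≡u : ∀ (u : Vecℤ n) → negᵛ (negᵛ u) ≡ u
neg[neg[u]]≡u []      = refl
neg[neg[u]]≡u (x ∷ u) = cong₂ _∷_ (ℤ.neg-involutive x) (neg[neg[u]]≡u u)

+ᵛ-comm : ∀ (u v : Vecℤ n) → u +ᵛ v ≡ v +ᵛ u
+ᵛ-comm []      []      = refl
+ᵛ-comm (x ∷ u) (y ∷ v) = cong₂ _∷_ (ℤ.+-comm x y) (+ᵛ-comm u v)

u-v-[-2·v]≡u+v : ∀ (u v : Vecℤ n) → (u -ᵛ v) -ᵛ (-[1+ 1 ] ·ᵛ v) ≡ u +ᵛ v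
u-v-[-2·v]≡u+v []      []      = refl
u-v-[-2·v]≡u+v (x ∷ u) (y ∷ v) = cong₂ _∷_ (identity x y) (u-v-[-2·v]≡u+v u v)
  where identity : ∀ x y → (x - y) - -[1+ 1 ] * y ≡ x + y
        identity = solve-∀

a+b≡c+d⇒d-a≡b-c : ∀ (a b c d : Vecℤ n) → a +ᵛ b ≡ c +ᵛ d → d -ᵛ a ≡ b -ᵛ c
a+b≡c+d⇒d-a≡b-c []      []      []      []      _ = refl
a+b≡c+d⇒d-a≡b-c (x ∷ a) (y ∷ b) (z ∷ c) (w ∷ d) eq =
  cong₂ _∷_ (identity x y z w (∷-injectiveˡ eq)) (a+b≡c+d⇒d-a≡b-c a b c d (∷-injectiveʳ eq))
  where identity : ∀ x y z w → x + y ≡ z + w → w - x ≡ y - z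
        identity x y z w e = begin
          w - x                 ≡⟨ shift x z w ⟩
          (z + w) - (x + z)     ≡⟨ cong (_- (x + z)) (sym e) ⟩
          (x + y) - (x + z)     ≡⟨ cancel x y z ⟩
          y - z                 ∎
          where
          open ≡-Reasoning
          shift : ∀ x z w → w - x ≡ (z + w) - (x + z)
          shift = solve-∀
          cancel : ∀ x y z → (x + y) - (x + z) ≡ y - z
          cancel = solve-∀

a+b≡c+c⇒b-[3·c]≡neg[a+c] : ∀ (a b c : Vecℤ n) → a +ᵛ b ≡ c +ᵛ c → b -ᵛ ((+ 3) ·ᵛ c) ≡ negᵛ (a +ᵛ c)
a+b≡c+c⇒b-[3·c]≡neg[a+c] []      []      []      _ = refl
a+b≡c+c⇒b-[3·c]≡neg[a+c] (x ∷ a) (y ∷ b) (z ∷ c) eq =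
  cong₂ _∷_ (identity x y z (∷-injectiveˡ eq)) (a+b≡c+c⇒b-[3·c]≡neg[a+c] a b c (∷-injectiveʳ eq))
  where identity : ∀ x y z → x + y ≡ z + z → y - + 3 * z ≡ - (x + z)
        identity x y z e = begin
          y - + 3 * z               ≡⟨ shift x y z ⟩
          (x + y) - + 3 * z - x     ≡⟨ cong (λ t → t - + 3 * z - x) e ⟩
          (z + z) - + 3 * z - x     ≡⟨ collect x z ⟩
          - (x + z)                 ∎
          where
          open ≡-Reasoning
          shift : ∀ x y z → y - + 3 * z ≡ (x + y) - + 3 * z - x
          shift = solve-∀
          collect : ∀ x z → (z + z) - + 3 * z - x ≡ - (x + z)
          collect = solve-∀

u-v≡0⇒u≡v : ∀ (u v : Vecℤ n) → u -ᵛ v ≡ 0ᵛ → u ≡ v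
u-v≡0⇒u≡v []      []      _  = refl
u-v≡0⇒u≡v (x ∷ u) (y ∷ v) eq = cong₂ _∷_ (ℤ.i-j≡0⇒i≡j x y (∷-injectiveˡ eq)) (u-v≡0⇒u≡v u v (∷-injectiveʳ eq))

nonneg≡neg[nonneg]⇒0 : ∀ (u v : Vecℤ n) → NonNeg u → NonNeg v → u ≡ negᵛ v → u ≡ 0ᵛ
nonneg≡neg[nonneg]⇒0 []      []      _  _  _  = refl
nonneg≡neg[nonneg]⇒0 (x ∷ u) (y ∷ v) u≥0 v≥0 eq = cong₂ _∷_
  (ℤ.≤-antisym (subst (_≤ 0ℤ) (sym (∷-injectiveˡ eq)) (ℤ.neg-mono-≤ (v≥0 zero))) (u≥0 zero))
  (nonneg≡neg[nonneg]⇒0 u v (u≥0 ∘ suc) (v≥0 ∘ suc) (∷-injectiveʳ eq))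

nonneg-antisym : ∀ (a c : Vecℤ n) → NonNeg (c -ᵛ a) → NonNeg (a -ᵛ c) → a ≡ c
nonneg-antisym []      []      _ _ = refl
nonneg-antisym (x ∷ a) (z ∷ c) c-a≥0 a-c≥0 = cong₂ _∷_
  (ℤ.≤-antisym (ℤ.0≤i-j⇒j≤i (c-a≥0 zero)) (ℤ.0≤i-j⇒j≤i (a-c≥0 zero)))
  (nonneg-antisym a c (c-a≥0 ∘ suc) (a-c≥0 ∘ suc))

module RootSystemProperties {n : ℕ} (R : RootSystem n) where
  open RootSystem R
  open BilinearForm G G-sym public

  private variable
    α β u v : Vecℤ n

  root≢0ᵛ : α ∈ Φ → α ≢ 0ᵛ
  root≢0ᵛ α∈Φ refl = zero∉Φ α∈Φ

  ∥root∥²>0 : α ∈ Φ → 0ℤ < ∥ α ∥²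
  ∥root∥²>0 {α} α∈Φ = G-posdef α (root≢0ᵛ α∈Φ)

  reflection∈Φ : ∀ k → α ∈ Φ → β ∈ Φ → + 2 * ⟪ α , β ⟫ ≡ k * ∥ β ∥² → α -ᵛ (k ·ᵛ β) ∈ Φ
  reflection∈Φ {α} {β} k α∈Φ β∈Φ 2⟪α,β⟫≡k∥β∥² with cryst α β α∈Φ β∈Φ
  ... | k′ , 2⟪α,β⟫≡k′∥β∥² , reflected∈Φ = subst (λ c → α -ᵛ (c ·ᵛ β) ∈ Φ) k′≡k reflected∈Φ
    where k′≡k : k′ ≡ k
          k′≡k = ℤ.*-cancelʳ-≡ k′ k ∥ β ∥² {{>-nonZero (∥root∥²>0 β∈Φ)}}
                   (trans (sym 2⟪α,β⟫≡k′∥β∥²) 2⟪α,β⟫≡k∥β∥²)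

  negᵛ∈Φ : α ∈ Φ → negᵛ α ∈ Φ
  negᵛ∈Φ {α} α∈Φ = subst (_∈ Φ) (u-[2·u]≡neg[u] α) (reflection∈Φ (+ 2) α∈Φ α∈Φ refl)

  -- z = ∥v∥² u − ⟪u,v⟫ v satisfies ∥z∥² = ∥v∥² (∥u∥² ∥v∥² − ⟪u,v⟫²), and z = 0 would make u, v
  -- proportional, hence v = ± u since Φ is reduced.
  ⟪⟫²<∥∥²∥∥² : u ∈ Φ → v ∈ Φ → v ≢ u → v ≢ negᵛ u → ⟪ u , v ⟫ * ⟪ u , v ⟫ < ∥ u ∥² * ∥ v ∥²
  ⟪⟫²<∥∥²∥∥² {u} {v} u∈Φ v∈Φ v≢u v≢-u with ⟪ u , v ⟫ ℤ.≟ 0ℤ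
  ... | yes w≡0 = subst (λ t → t * t < ∥ u ∥² * ∥ v ∥²) (sym w≡0) (*-pos (∥root∥²>0 u∈Φ) (∥root∥²>0 v∈Φ))
  ... | no w≢0 with Data.Vec.Properties.≡-dec ℤ._≟_ ((∥ v ∥² ·ᵛ u) -ᵛ (⟪ u , v ⟫ ·ᵛ v)) 0ᵛ
  ...   | yes z≡0 = ⊥-elim ([_,_] v≢u v≢-u (reduced u v u∈Φ v∈Φ ∥ v ∥² ⟪ u , v ⟫
                      (ℤ.<⇒≢ (∥root∥²>0 v∈Φ) ∘ sym) w≢0 (u-v≡0⇒u≡v _ _ z≡0)))
  ...   | no z≢0 = 0<j-i⇒i<j (pos-factor (∥root∥²>0 v∈Φ) (subst (0ℤ <_) ∥z∥²≡ (G-posdef _ z≢0)))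
    where
    ∥z∥²≡ : ∥ (∥ v ∥² ·ᵛ u) -ᵛ (⟪ u , v ⟫ ·ᵛ v) ∥² ≡ ∥ v ∥² * (∥ u ∥² * ∥ v ∥² - ⟪ u , v ⟫ * ⟪ u , v ⟫)
    ∥z∥²≡ = trans (∥·ᵛ-·ᵛ∥² ∥ v ∥² ⟪ u , v ⟫ u v) (factor ∥ u ∥² ∥ v ∥² ⟪ u , v ⟫)
      where factor : ∀ U V w → V * V * U - + 2 * V * w * w + w * w * V ≡ V * (U * V - w * w)
            factor = solve-∀

  record Acute (u v : Vecℤ n) : Set where
    constructor acute
    field
      u∈Φ     : u ∈ Φ
      v∈Φ     : v ∈ Φ
      v≢u     : v ≢ u
      0<⟪u,v⟫ : 0ℤ < ⟪ u , v ⟫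

  Acute-sym : Acute u v → Acute v u
  Acute-sym {u} {v} (acute u∈Φ v∈Φ v≢u 0<⟪u,v⟫) = acute v∈Φ u∈Φ (≢-sym v≢u) (subst (0ℤ <_) (⟪⟫-sym u v) 0<⟪u,v⟫)

  acute-norms : Acute u v → AcuteNorms ∥ u ∥² ∥ v ∥² ⟪ u , v ⟫
  acute-norms {u} {v} uv with cryst u v u∈Φ v∈Φ | cryst v u v∈Φ u∈Φ
    where open Acute uv
  ... | k , 2w≡kV , _ | k′ , 2w′≡k′U , _ =
    acute-norms-of-cartan {k = k} {k′ = k′} (∥root∥²>0 u∈Φ) (∥root∥²>0 v∈Φ) 0<⟪u,v⟫
      2w≡kV (trans (cong (+ 2 *_) (⟪⟫-sym u v)) 2w′≡k′U) (⟪⟫²<∥∥²∥∥² u∈Φ v∈Φ v≢u v≢-u)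
    where
    open Acute uv
    v≢-u : v ≢ negᵛ u
    v≢-u refl = ℤ.<-asym 0<⟪u,v⟫ (subst (_< 0ℤ) (sym (⟪negᵛ⟫ʳ u u)) (ℤ.neg-mono-< (∥root∥²>0 u∈Φ)))

  acute-difference∈Φ : Acute u v → u -ᵛ v ∈ Φ
  acute-difference∈Φ {u} {v} uv with ℤ.≤-total ∥ u ∥² ∥ v ∥²
  ... | inj₁ U≤V = subst (_∈ Φ) (u-[1·v]≡u-v u v)
        (reflection∈Φ 1ℤ u∈Φ v∈Φ (trans (≤⇒2w≡V U≤V) (sym (ℤ.*-identityˡ ∥ v ∥²))))
    where open Acute uv
          open AcuteNorms (acute-norms uv)
  ... | inj₂ V≤U = subst (_∈ Φ) (neg[v-u]≡u-v u v) (negᵛ∈Φ (subst (_∈ Φ) (u-[1·v]≡u-v v u)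
        (reflection∈Φ 1ℤ v∈Φ u∈Φ (trans (cong (+ 2 *_) (⟪⟫-sym v u))
          (trans (≥⇒2w≡U V≤U) (sym (ℤ.*-identityˡ ∥ u ∥²)))))))
    where open Acute uv
          open AcuteNorms (acute-norms uv)

  acute-∥u-v∥²≡∥u∥² : Acute u v → ∥ u ∥² ≤ ∥ v ∥² → ∥ u -ᵛ v ∥² ≡ ∥ u ∥²
  acute-∥u-v∥²≡∥u∥² {u} {v} uv U≤V = trans (∥-ᵛ∥² u v) (U-2w+V≡U (acute-norms uv) U≤V)

  acute-∥u-v∥²≡∥v∥² : Acute u v → ∥ v ∥² ≤ ∥ u ∥² → ∥ u -ᵛ v ∥² ≡ ∥ v ∥²
  acute-∥u-v∥²≡∥v∥² {u} {v} uv V≤U = trans (∥-ᵛ∥² u v) (U-2w+V≡V (acute-norms uv) V≤U)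

  pairing-nonneg : u ∈ Φ → v ∈ Φ → NonNeg u → NonNeg v → u +ᵛ v ∉ Φ → 0ℤ ≤ ⟪ u , v ⟫
  pairing-nonneg {u} {v} u∈Φ v∈Φ u≥0 v≥0 u+v∉Φ with 0ℤ ℤ.≤? ⟪ u , v ⟫
  ... | yes 0≤w = 0≤w
  ... | no 0≰w = ⊥-elim (u+v∉Φ (subst (_∈ Φ) (u-neg[v]≡u+v u v)
                   (acute-difference∈Φ (acute u∈Φ (negᵛ∈Φ v∈Φ) -v≢u 0<⟪u,-v⟫))))
    where
    0<⟪u,-v⟫ : 0ℤ < ⟪ u , negᵛ v ⟫
    0<⟪u,-v⟫ = subst (0ℤ <_) (sym (⟪negᵛ⟫ʳ v u)) (ℤ.neg-mono-< (ℤ.≰⇒> 0≰w))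
    -v≢u : negᵛ v ≢ u
    -v≢u -v≡u = root≢0ᵛ u∈Φ (nonneg≡neg[nonneg]⇒0 u v u≥0 v≥0 (sym -v≡u))

  2⟪⟫≤ : u ∈ Φ → v ∈ Φ → v ≢ u → 0ℤ ≤ ⟪ u , v ⟫ → ∥ u ∥² ≤ M → ∥ v ∥² ≤ M → + 2 * ⟪ u , v ⟫ ≤ M
  2⟪⟫≤ {u} {v} u∈Φ v∈Φ v≢u 0≤w U≤M V≤M with ℤ.<-cmp 0ℤ ⟪ u , v ⟫ | ℤ.≤-total ∥ u ∥² ∥ v ∥²
  ... | tri< 0<w _ _ | inj₁ U≤V = subst (_≤ _) (sym (≤⇒2w≡V U≤V)) V≤M
    where open AcuteNorms (acute-norms (acute u∈Φ v∈Φ v≢u 0<w))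
  ... | tri< 0<w _ _ | inj₂ V≤U = subst (_≤ _) (sym (≥⇒2w≡U V≤U)) U≤M
    where open AcuteNorms (acute-norms (acute u∈Φ v∈Φ v≢u 0<w))
  ... | tri≈ _ 0≡w _ | _ = subst (λ t → + 2 * t ≤ _) 0≡w (ℤ.≤-trans (ℤ.<⇒≤ (∥root∥²>0 u∈Φ)) U≤M)
  ... | tri> _ _ w<0 | _ = ⊥-elim (ℤ.<⇒≱ w<0 0≤w)

  nonorthogonal-norm-ratio : u ∈ Φ → v ∈ Φ → ⟪ u , v ⟫ ≢ 0ℤ → ∥ u ∥² < ∥ v ∥² →
                             + 2 * ∥ u ∥² ≤ ∥ v ∥² × ∥ v ∥² ≤ + 3 * ∥ u ∥²
  nonorthogonal-norm-ratio {u} {v} u∈Φ v∈Φ w≢0 U<V with ℤ.<-cmp 0ℤ ⟪ u , v ⟫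
  ... | tri< 0<w _ _ = AcuteNorms.<⇒2U≤V≤3U (acute-norms (acute u∈Φ v∈Φ v≢u 0<w)) U<V
    where v≢u : v ≢ u
          v≢u refl = ℤ.<-irrefl refl U<V
  ... | tri≈ _ 0≡w _ = ⊥-elim (w≢0 (sym 0≡w))
  ... | tri> _ _ w<0 = subst (λ U → + 2 * U ≤ ∥ v ∥² × ∥ v ∥² ≤ + 3 * U) (∥negᵛ∥² u)
        (AcuteNorms.<⇒2U≤V≤3U (acute-norms (acute (negᵛ∈Φ u∈Φ) v∈Φ v≢-u 0<⟪-u,v⟫)) (subst (_< ∥ v ∥²) (sym (∥negᵛ∥² u)) U<V))
    where
    v≢-u : v ≢ negᵛ u
    v≢-u refl = ℤ.<-irrefl (sym (∥negᵛ∥² u)) U<V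
    0<⟪-u,v⟫ : 0ℤ < ⟪ negᵛ u , v ⟫
    0<⟪-u,v⟫ = subst (0ℤ <_) (sym (⟪negᵛ⟫ˡ u v)) (ℤ.neg-mono-< w<0)

  Long-≤ : Long R u → ∥ u ∥² ≤ ∥ v ∥² → Long R v
  Long-≤ u-long U≤V β β∈Φ = ℤ.≤-trans (u-long β β∈Φ) U≤V

  Long-negᵛ : Long R u → Long R (negᵛ u)
  Long-negᵛ {u} u-long = Long-≤ {u} {negᵛ u} u-long (ℤ.≤-reflexive (sym (∥negᵛ∥² u)))

  short<long : v ∈ Φ → Short R v → Long R u → ∥ v ∥² < ∥ u ∥²
  short<long {v} {u} v∈Φ v-short u-long with ∥ u ∥² ℤ.≤? ∥ v ∥²
  ... | yes U≤V = ⊥-elim (v-short (Long-≤ {u} {v} u-long U≤V))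
  ... | no U≰V = ℤ.≰⇒> U≰V

  long-difference⇒equal-norms : Acute u v → Long R (u -ᵛ v) → ∥ u ∥² ≡ ∥ u -ᵛ v ∥² × ∥ v ∥² ≡ ∥ u -ᵛ v ∥²
  long-difference⇒equal-norms {u} {v} uv diff-long with ℤ.≤-total ∥ u ∥² ∥ v ∥²
  ... | inj₁ U≤V = sym X≡U , ℤ.≤-antisym (diff-long v v∈Φ) (subst (_≤ ∥ v ∥²) (sym X≡U) U≤V)
    where open Acute uv
          X≡U : ∥ u -ᵛ v ∥² ≡ ∥ u ∥²
          X≡U = acute-∥u-v∥²≡∥u∥² uv U≤V
  ... | inj₂ V≤U = ℤ.≤-antisym (diff-long u u∈Φ) (subst (_≤ ∥ u ∥²) (sym X≡V) V≤U) , sym X≡V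
    where open Acute uv
          X≡V : ∥ u -ᵛ v ∥² ≡ ∥ v ∥²
          X≡V = acute-∥u-v∥²≡∥v∥² uv V≤U

  long-pair⇒long-difference : Acute u v → Long R u → Long R v → Long R (u -ᵛ v)
  long-pair⇒long-difference {u} {v} uv u-long v-long =
    Long-≤ {u} {u -ᵛ v} u-long (ℤ.≤-reflexive (sym (acute-∥u-v∥²≡∥u∥² uv (v-long u (Acute.u∈Φ uv)))))

  long-minus-short⇒short : Acute u v → Long R u → Short R (u -ᵛ v) → Short R v
  long-minus-short⇒short {u} {v} uv u-long diff-short v-long =
    diff-short (Long-≤ {v} {u -ᵛ v} v-long (ℤ.≤-reflexive (sym (acute-∥u-v∥²≡∥v∥² uv (u-long v (Acute.v∈Φ uv))))))

  module _ (irreducible : Irreducible R) where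
    private
      SameNormWitness : Vecℤ n → Vecℤ n → Vecℤ n → Set
      SameNormWitness α γ α′ = ∥ α′ ∥² ≡ ∥ α ∥² × ⟪ α′ , γ ⟫ ≢ 0ℤ

      Reaches : Vecℤ n → Vecℤ n → Set
      Reaches α γ = Any (SameNormWitness α γ) Φ

      reaches? : ∀ α γ → Dec (Reaches α γ)
      reaches? α γ = any? (λ α′ → (∥ α′ ∥² ℤ.≟ ∥ α ∥²) ×-dec ¬? (⟪ α′ , γ ⟫ ℤ.≟ 0ℤ)) Φ

      reaches-nonorthogonal : ∀ {α γ δ} → γ ∈ Φ → ⟪ γ , δ ⟫ ≢ 0ℤ → Reaches α γ → Reaches α δ
      reaches-nonorthogonal {α} {γ} {δ} γ∈Φ ⟪γ,δ⟫≢0 reach with find reach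
      ... | α′ , α′∈Φ , same-norm , ⟪α′,γ⟫≢0 with ⟪ α′ , δ ⟫ ℤ.≟ 0ℤ
      ...   | no ⟪α′,δ⟫≢0 = lose α′∈Φ (same-norm , ⟪α′,δ⟫≢0)
      ...   | yes ⟪α′,δ⟫≡0 with cryst α′ γ α′∈Φ γ∈Φ
      ...     | k , 2⟪α′,γ⟫≡k∥γ∥² , reflected∈Φ =
        lose reflected∈Φ (trans (∥reflection∥² α′ γ k 2⟪α′,γ⟫≡k∥γ∥²) same-norm , ⟪reflected,δ⟫≢0)
        where
        k≢0 : k ≢ 0ℤ
        k≢0 refl = ⟪α′,γ⟫≢0 (ℤ.*-cancelˡ-≡ (+ 2) ⟪ α′ , γ ⟫ 0ℤ 2⟪α′,γ⟫≡k∥γ∥²)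
        ⟪reflected,δ⟫≢0 : ⟪ α′ -ᵛ (k ·ᵛ γ) , δ ⟫ ≢ 0ℤ
        ⟪reflected,δ⟫≢0 eq = [_,_] k≢0 ⟪γ,δ⟫≢0 (ℤ.i*j≡0⇒i≡0∨j≡0 k (begin
          k * ⟪ γ , δ ⟫                      ≡⟨ negate-twice (k * ⟪ γ , δ ⟫) ⟩
          - (0ℤ - k * ⟪ γ , δ ⟫)              ≡⟨ cong (λ t → - (t - k * ⟪ γ , δ ⟫)) ⟪α′,δ⟫≡0 ⟨
          - (⟪ α′ , δ ⟫ - k * ⟪ γ , δ ⟫)       ≡⟨ cong (λ t → - (⟪ α′ , δ ⟫ - t)) (⟪·ᵛ⟫ˡ k γ δ) ⟨
          - (⟪ α′ , δ ⟫ - ⟪ k ·ᵛ γ , δ ⟫)      ≡⟨ cong -_ (⟪-ᵛ⟫ˡ α′ (k ·ᵛ γ) δ) ⟨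
          - ⟪ α′ -ᵛ (k ·ᵛ γ) , δ ⟫            ≡⟨ cong -_ eq ⟩
          0ℤ                                 ∎))
          where
          open ≡-Reasoning
          negate-twice : ∀ x → x ≡ - (0ℤ - x)
          negate-twice = solve-∀

    -- Otherwise Φ splits into the roots γ with Reaches α γ (among them α) and the rest, and these
    -- two parts are orthogonal because Reaches α propagates along non-orthogonal pairs.
    nonorthogonal-of-same-norm : α ∈ Φ → β ∈ Φ →
                                 Σ (Vecℤ n) λ α′ → α′ ∈ Φ × ∥ α′ ∥² ≡ ∥ α ∥² × ⟪ α′ , β ⟫ ≢ 0ℤ
    nonorthogonal-of-same-norm {α} {β} α∈Φ β∈Φ with reaches? α β
    ... | yes reach = find reach
    ... | no ¬reach = ⊥-elim (irreducible
          ( (λ γ → does (reaches? α γ))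
          , (α , α∈Φ , dec-true (reaches? α α) (lose α∈Φ (refl , ℤ.<⇒≢ (∥root∥²>0 α∈Φ) ∘ sym)))
          , (β , β∈Φ , dec-false (reaches? α β) ¬reach)
          , orthogonal ))
      where
      orthogonal : ∀ γ δ → γ ∈ Φ → δ ∈ Φ → does (reaches? α γ) ≡ true → does (reaches? α δ) ≡ false →
                   ⟪ γ , δ ⟫ ≡ 0ℤ
      orthogonal γ δ γ∈Φ _ _ _ with ⟪ γ , δ ⟫ ℤ.≟ 0ℤ | reaches? α γ | reaches? α δ
      ... | yes ⟪γ,δ⟫≡0 | _     | _    = ⟪γ,δ⟫≡0
      ... | no ⟪γ,δ⟫≢0  | yes r | no ¬r = ⊥-elim (¬r (reaches-nonorthogonal {α = α} {δ = δ} γ∈Φ ⟪γ,δ⟫≢0 r))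

    norm-ratio : u ∈ Φ → v ∈ Φ → ∥ u ∥² < ∥ v ∥² → + 2 * ∥ u ∥² ≤ ∥ v ∥² × ∥ v ∥² ≤ + 3 * ∥ u ∥²
    norm-ratio {u} {v} u∈Φ v∈Φ U<V with nonorthogonal-of-same-norm u∈Φ v∈Φ
    ... | u′ , u′∈Φ , ∥u′∥²≡U , ⟪u′,v⟫≢0 = subst (λ U → + 2 * U ≤ ∥ v ∥² × ∥ v ∥² ≤ + 3 * U) ∥u′∥²≡U
          (nonorthogonal-norm-ratio u′∈Φ v∈Φ ⟪u′,v⟫≢0 (subst (_< ∥ v ∥²) (sym ∥u′∥²≡U) U<V))

    longer-root-is-long : u ∈ Φ → v ∈ Φ → ∥ u ∥² < ∥ v ∥² → Long R v
    longer-root-is-long {u} {v} u∈Φ v∈Φ U<V z z∈Φ with ∥ z ∥² ℤ.≤? ∥ v ∥²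
    ... | yes Z≤V = Z≤V
    ... | no Z≰V = ⊥-elim (ℤ.<⇒≱ 3U<4U (begin
          + 4 * ∥ u ∥²       ≡⟨ regroup ∥ u ∥² ⟩
          + 2 * (+ 2 * ∥ u ∥²) ≤⟨ ℤ.*-monoˡ-≤-nonNeg (+ 2) (proj₁ (norm-ratio u∈Φ v∈Φ U<V)) ⟩
          + 2 * ∥ v ∥²        ≤⟨ proj₁ (norm-ratio v∈Φ z∈Φ V<Z) ⟩
          ∥ z ∥²              ≤⟨ proj₂ (norm-ratio u∈Φ z∈Φ (ℤ.<-trans U<V V<Z)) ⟩
          + 3 * ∥ u ∥²        ∎))
      where
      open ℤ.≤-Reasoning
      V<Z : ∥ v ∥² < ∥ z ∥²
      V<Z = ℤ.≰⇒> Z≰V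
      regroup : ∀ U → + 4 * U ≡ + 2 * (+ 2 * U)
      regroup = solve-∀
      3U<4U : + 3 * ∥ u ∥² < + 4 * ∥ u ∥²
      3U<4U = 3x<4x (∥root∥²>0 u∈Φ)

module AbelianIdealQuadruples {n : ℕ} (R : RootSystem n) (irreducible : Irreducible R)
                              (I : Vecℤ n → Set) (ideal : AbelianIdeal R I) where
  open RootSystem R
  open RootSystemProperties R
  open AbelianIdeal ideal

  private variable u v : Vecℤ n

  I⊆Φ : I u → u ∈ Φ
  I⊆Φ {u} u∈I = proj₁ (⊆Φ⁺ u u∈I)

  0≤⟪⟫ : I u → I v → 0ℤ ≤ ⟪ u , v ⟫
  0≤⟪⟫ {u} {v} u∈I v∈I = pairing-nonneg (I⊆Φ u∈I) (I⊆Φ v∈I) (proj₂ (⊆Φ⁺ u u∈I)) (proj₂ (⊆Φ⁺ v v∈I)) (abelian u v u∈I v∈I)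

  -- (a, b, c, d) plays the role of (β₁, β₂, γ₁, γ₂), so that x = b − c and y = b − d.
  record Config (a b c d : Vecℤ n) : Set where
    field
      a∈I     : I a
      b∈I     : I b
      c∈I     : I c
      d∈I     : I d
      a+b≡c+d : a +ᵛ b ≡ c +ᵛ d
      a≢c     : a ≢ c
      c≢b     : c ≢ b
      a≢d     : a ≢ d
      d≢b     : d ≢ b
      a≢b     : a ≢ b

  swap-cd : ∀ {a b c d} → Config a b c d → Config a b d c
  swap-cd cfg = record
    { a∈I = a∈I ; b∈I = b∈I ; c∈I = d∈I ; d∈I = c∈I ; a+b≡c+d = trans a+b≡c+d (+ᵛ-comm _ _)
    ; a≢c = a≢d ; c≢b = d≢b ; a≢d = a≢c ; d≢b = c≢b ; a≢b = a≢b }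
    where open Config cfg

  swap-ab : ∀ {a b c d} → Config a b c d → Config b a c d
  swap-ab cfg = record
    { a∈I = b∈I ; b∈I = a∈I ; c∈I = c∈I ; d∈I = d∈I ; a+b≡c+d = trans (+ᵛ-comm _ _) a+b≡c+d
    ; a≢c = ≢-sym c≢b ; c≢b = ≢-sym a≢c ; a≢d = ≢-sym d≢b ; d≢b = ≢-sym a≢d ; a≢b = ≢-sym a≢b }
    where open Config cfg

  swap-pairs : ∀ {a b c d} → Config a b c d → c ≢ d → Config c d a b
  swap-pairs cfg c≢d = record
    { a∈I = c∈I ; b∈I = d∈I ; c∈I = a∈I ; d∈I = b∈I ; a+b≡c+d = sym a+b≡c+d
    ; a≢c = ≢-sym a≢c ; c≢b = a≢d ; a≢d = c≢b ; d≢b = ≢-sym d≢b ; a≢b = c≢d }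
    where open Config cfg

  module ConfigBasics {a b c d : Vecℤ n} (cfg : Config a b c d) where
    open Config cfg

    a∈Φ : a ∈ Φ
    a∈Φ = I⊆Φ a∈I
    b∈Φ : b ∈ Φ
    b∈Φ = I⊆Φ b∈I
    c∈Φ : c ∈ Φ
    c∈Φ = I⊆Φ c∈I
    d∈Φ : d ∈ Φ
    d∈Φ = I⊆Φ d∈I

    pairing-sum : ∀ u → ⟪ a , u ⟫ + ⟪ b , u ⟫ ≡ ⟪ c , u ⟫ + ⟪ d , u ⟫
    pairing-sum u = trans (sym (⟪+ᵛ⟫ˡ a b u)) (trans (cong (λ t → ⟪ t , u ⟫) a+b≡c+d) (⟪+ᵛ⟫ˡ c d u))

    norm-sum : ∥ a ∥² + + 2 * ⟪ a , b ⟫ + ∥ b ∥² ≡ ∥ c ∥² + + 2 * ⟪ c , d ⟫ + ∥ d ∥²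
    norm-sum = trans (sym (∥+ᵛ∥² a b)) (trans (cong ∥_∥² a+b≡c+d) (∥+ᵛ∥² c d))

    ⟪b,c⟫≡0⇒0<⟪d,a⟫ : ⟪ b , c ⟫ ≡ 0ℤ → 0ℤ < ⟪ d , a ⟫
    ⟪b,c⟫≡0⇒0<⟪d,a⟫ ⟪b,c⟫≡0 = pos-factor {x = + 2} (+<+ (s≤s z≤n)) (begin-strict
      0ℤ                              <⟨ ∥root∥²>0 a∈Φ ⟩
      ∥ a ∥²                          ≤⟨ x≤x+y (ℤ.*-monoˡ-≤-nonNeg (+ 2) (0≤⟪⟫ b∈I a∈I)) ⟩
      ∥ a ∥² + + 2 * ⟪ b , a ⟫         ≡⟨ 2⟪d,a⟫≡ ⟨
      + 2 * ⟪ d , a ⟫                 ∎)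
      where
      open ℤ.≤-Reasoning
      C≤⟪a,c⟫ : ∥ c ∥² ≤ ⟪ a , c ⟫
      C≤⟪a,c⟫ = begin
        ∥ c ∥²                  ≤⟨ x≤x+y (0≤⟪⟫ d∈I c∈I) ⟩
        ∥ c ∥² + ⟪ d , c ⟫      ≡⟨ pairing-sum c ⟨
        ⟪ a , c ⟫ + ⟪ b , c ⟫   ≡⟨ cong (_+_ ⟪ a , c ⟫) ⟪b,c⟫≡0 ⟩
        ⟪ a , c ⟫ + 0ℤ          ≡⟨ ℤ.+-identityʳ ⟪ a , c ⟫ ⟩
        ⟪ a , c ⟫               ∎
      ac-norms : AcuteNorms ∥ a ∥² ∥ c ∥² ⟪ a , c ⟫
      ac-norms = acute-norms (acute a∈Φ c∈Φ (≢-sym a≢c) (ℤ.<-≤-trans (∥root∥²>0 c∈Φ) C≤⟪a,c⟫))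
      2⟪a,c⟫≡A : + 2 * ⟪ a , c ⟫ ≡ ∥ a ∥²
      2⟪a,c⟫≡A with ℤ.≤-total ∥ c ∥² ∥ a ∥²
      ... | inj₁ C≤A = AcuteNorms.≥⇒2w≡U ac-norms C≤A
      ... | inj₂ A≤C = ⊥-elim (ℤ.<⇒≱ (x<2x (∥root∥²>0 c∈Φ)) (begin
            + 2 * ∥ c ∥²      ≤⟨ ℤ.*-monoˡ-≤-nonNeg (+ 2) C≤⟪a,c⟫ ⟩
            + 2 * ⟪ a , c ⟫   ≡⟨ AcuteNorms.≤⇒2w≡V ac-norms A≤C ⟩
            ∥ c ∥²            ∎))
      2⟪d,a⟫≡ : + 2 * ⟪ d , a ⟫ ≡ ∥ a ∥² + + 2 * ⟪ b , a ⟫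
      2⟪d,a⟫≡ = begin-equality
        + 2 * ⟪ d , a ⟫                                  ≡⟨ isolate ⟪ c , a ⟫ ⟪ d , a ⟫ ⟩
        + 2 * (⟪ c , a ⟫ + ⟪ d , a ⟫) - + 2 * ⟪ c , a ⟫   ≡⟨ cong₂ (λ s t → + 2 * s - t) (sym (pairing-sum a))
                                                              (trans (cong (+ 2 *_) (⟪⟫-sym c a)) 2⟪a,c⟫≡A) ⟩
        + 2 * (∥ a ∥² + ⟪ b , a ⟫) - ∥ a ∥²                ≡⟨ simplify ∥ a ∥² ⟪ b , a ⟫ ⟩
        ∥ a ∥² + + 2 * ⟪ b , a ⟫                          ∎
        where
        isolate : ∀ x y → + 2 * y ≡ + 2 * (x + y) - + 2 * x
        isolate = solve-∀
        simplify : ∀ A x → + 2 * (A + x) - A ≡ A + + 2 * x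
        simplify = solve-∀

    -- If b ⊥ c then b − c = d − a is a root, and reflecting it in c gives b + c.
    0<⟪b,c⟫ : 0ℤ < ⟪ b , c ⟫
    0<⟪b,c⟫ with ⟪ b , c ⟫ ℤ.≤? 0ℤ
    ... | no ⟪b,c⟫≰0 = ℤ.≰⇒> ⟪b,c⟫≰0
    ... | yes ⟪b,c⟫≤0 = ⊥-elim (abelian b c b∈I c∈I (subst (_∈ Φ) (u-v-[-2·v]≡u+v b c) b-c+2c∈Φ))
      where
      ⟪b,c⟫≡0 : ⟪ b , c ⟫ ≡ 0ℤ
      ⟪b,c⟫≡0 = ℤ.≤-antisym ⟪b,c⟫≤0 (0≤⟪⟫ b∈I c∈I)
      b-c∈Φ : b -ᵛ c ∈ Φ
      b-c∈Φ = subst (_∈ Φ) (a+b≡c+d⇒d-a≡b-c a b c d a+b≡c+d)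
                (acute-difference∈Φ (acute d∈Φ a∈Φ a≢d (⟪b,c⟫≡0⇒0<⟪d,a⟫ ⟪b,c⟫≡0)))
      2⟪b-c,c⟫≡-2C : + 2 * ⟪ b -ᵛ c , c ⟫ ≡ -[1+ 1 ] * ∥ c ∥²
      2⟪b-c,c⟫≡-2C = begin
        + 2 * ⟪ b -ᵛ c , c ⟫        ≡⟨ cong (+ 2 *_) (⟪-ᵛ⟫ˡ b c c) ⟩
        + 2 * (⟪ b , c ⟫ - ∥ c ∥²)  ≡⟨ cong (λ t → + 2 * (t - ∥ c ∥²)) ⟪b,c⟫≡0 ⟩
        + 2 * (0ℤ - ∥ c ∥²)         ≡⟨ collect ∥ c ∥² ⟩
        -[1+ 1 ] * ∥ c ∥²           ∎
        where open ≡-Reasoning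
              collect : ∀ C → + 2 * (0ℤ - C) ≡ -[1+ 1 ] * C
              collect = solve-∀
      b-c+2c∈Φ : (b -ᵛ c) -ᵛ (-[1+ 1 ] ·ᵛ c) ∈ Φ
      b-c+2c∈Φ = reflection∈Φ -[1+ 1 ] b-c∈Φ c∈Φ 2⟪b-c,c⟫≡-2C

    bc : Acute b c
    bc = acute b∈Φ c∈Φ c≢b 0<⟪b,c⟫

    b-c∈Φ : b -ᵛ c ∈ Φ
    b-c∈Φ = acute-difference∈Φ bc

    ∥b-c∥²≡∥d-a∥² : ∥ b -ᵛ c ∥² ≡ ∥ d -ᵛ a ∥²
    ∥b-c∥²≡∥d-a∥² = cong ∥_∥² (sym (a+b≡c+d⇒d-a≡b-c a b c d a+b≡c+d))

  module ConfigNorms {a b c d : Vecℤ n} (cfg : Config a b c d) where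
    open Config cfg
    open ConfigBasics cfg

    bd : Acute b d
    bd = ConfigBasics.bc (swap-cd cfg)

    ac : Acute a c
    ac = ConfigBasics.bc (swap-ab cfg)

    da : Acute d a
    da = Acute-sym (ConfigBasics.bc (swap-ab (swap-cd cfg)))

    x-long⇒all-long : Long R (b -ᵛ c) →
                      Long R (b -ᵛ d) × Long R a × Long R b × Long R c × Long R d
    x-long⇒all-long x-long = norm≡X⇒long (b -ᵛ d) Y≡X , norm≡X⇒long a A≡X , norm≡X⇒long b B≡X
                           , norm≡X⇒long c C≡X , norm≡X⇒long d D≡X
      where
      norm≡X⇒long : ∀ v → ∥ v ∥² ≡ ∥ b -ᵛ c ∥² → Long R v
      norm≡X⇒long v eq = Long-≤ {b -ᵛ c} {v} x-long (ℤ.≤-reflexive (sym eq))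
      B≡X : ∥ b ∥² ≡ ∥ b -ᵛ c ∥²
      B≡X = proj₁ (long-difference⇒equal-norms bc x-long)
      C≡X : ∥ c ∥² ≡ ∥ b -ᵛ c ∥²
      C≡X = proj₂ (long-difference⇒equal-norms bc x-long)
      d-a-long : Long R (d -ᵛ a)
      d-a-long = subst (Long R) (sym (a+b≡c+d⇒d-a≡b-c a b c d a+b≡c+d)) x-long
      D≡X : ∥ d ∥² ≡ ∥ b -ᵛ c ∥²
      D≡X = trans (proj₁ (long-difference⇒equal-norms da d-a-long)) (sym ∥b-c∥²≡∥d-a∥²)
      A≡X : ∥ a ∥² ≡ ∥ b -ᵛ c ∥²
      A≡X = trans (proj₂ (long-difference⇒equal-norms da d-a-long)) (sym ∥b-c∥²≡∥d-a∥²)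
      Y≡X : ∥ b -ᵛ d ∥² ≡ ∥ b -ᵛ c ∥²
      Y≡X = trans (acute-∥u-v∥²≡∥u∥² bd (ℤ.≤-reflexive (trans B≡X (sym D≡X)))) B≡X

    ab-long⇒⊥ : d ≢ c → Short R (b -ᵛ c) → Short R (b -ᵛ d) → Long R a → Long R b → ⊥
    ab-long⇒⊥ d≢c x-short y-short a-long b-long = ℤ.<⇒≱ (3x<4x (∥root∥²>0 a∈Φ)) (begin
      + 4 * ∥ a ∥²                                       ≤⟨ x≤x+y (ℤ.*-monoˡ-≤-nonNeg (+ 4) (0≤⟪⟫ a∈I b∈I)) ⟩
      + 4 * ∥ a ∥² + + 4 * ⟪ a , b ⟫                       ≡⟨ regroup ∥ a ∥² ⟪ a , b ⟫ ⟩
      + 2 * (∥ a ∥² + + 2 * ⟪ a , b ⟫ + ∥ a ∥²)             ≡⟨ cong (λ t → + 2 * (∥ a ∥² + + 2 * ⟪ a , b ⟫ + t)) B≡A ⟨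
      + 2 * (∥ a ∥² + + 2 * ⟪ a , b ⟫ + ∥ b ∥²)             ≡⟨ cong (+ 2 *_) norm-sum ⟩
      + 2 * (∥ c ∥² + + 2 * ⟪ c , d ⟫ + ∥ d ∥²)             ≡⟨ distrib ∥ c ∥² ⟪ c , d ⟫ ∥ d ∥² ⟩
      + 2 * ∥ c ∥² + + 2 * (+ 2 * ⟪ c , d ⟫) + + 2 * ∥ d ∥²  ≤⟨ ℤ.+-mono-≤ (ℤ.+-mono-≤ 2C≤A 4⟪c,d⟫≤A) 2D≤A ⟩
      ∥ a ∥² + ∥ a ∥² + ∥ a ∥²                              ≡⟨ triple ∥ a ∥² ⟩
      + 3 * ∥ a ∥²                                        ∎)
      where
      open ℤ.≤-Reasoning
      B≡A : ∥ b ∥² ≡ ∥ a ∥²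
      B≡A = ℤ.≤-antisym (a-long b b∈Φ) (b-long a a∈Φ)
      C<A : ∥ c ∥² < ∥ a ∥²
      C<A = short<long {u = a} c∈Φ (long-minus-short⇒short bc b-long x-short) a-long
      D<A : ∥ d ∥² < ∥ a ∥²
      D<A = short<long {u = a} d∈Φ (long-minus-short⇒short bd b-long y-short) a-long
      2C≤A : + 2 * ∥ c ∥² ≤ ∥ a ∥²
      2C≤A = proj₁ (norm-ratio irreducible c∈Φ a∈Φ C<A)
      2D≤A : + 2 * ∥ d ∥² ≤ ∥ a ∥²
      2D≤A = proj₁ (norm-ratio irreducible d∈Φ a∈Φ D<A)
      4⟪c,d⟫≤A : + 2 * (+ 2 * ⟪ c , d ⟫) ≤ ∥ a ∥²
      4⟪c,d⟫≤A with ℤ.≤-total ∥ c ∥² ∥ d ∥²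
      ... | inj₁ C≤D = ℤ.≤-trans (ℤ.*-monoˡ-≤-nonNeg (+ 2) (2⟪⟫≤ c∈Φ d∈Φ d≢c (0≤⟪⟫ c∈I d∈I) C≤D ℤ.≤-refl)) 2D≤A
      ... | inj₂ D≤C = ℤ.≤-trans (ℤ.*-monoˡ-≤-nonNeg (+ 2) (2⟪⟫≤ c∈Φ d∈Φ d≢c (0≤⟪⟫ c∈I d∈I) ℤ.≤-refl D≤C)) 2C≤A
      regroup : ∀ A w → + 4 * A + + 4 * w ≡ + 2 * (A + + 2 * w + A)
      regroup = solve-∀
      distrib : ∀ C w D → + 2 * (C + + 2 * w + D) ≡ + 2 * C + + 2 * (+ 2 * w) + + 2 * D
      distrib = solve-∀
      triple : ∀ A → A + A + A ≡ + 3 * A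
      triple = solve-∀

  module _ {a b c d : Vecℤ n} (cfg : Config a b c d) where
    open Config cfg
    open ConfigBasics cfg
    open ConfigNorms cfg

    some-short⇒x-short : Short R (b -ᵛ c) ⊎ Short R (b -ᵛ d) ⊎ Short R a ⊎ Short R b ⊎ Short R c ⊎ Short R d →
                         Short R (b -ᵛ c)
    some-short⇒x-short some-short x-long = refute some-short
      where
      all-long : Long R (b -ᵛ d) × Long R a × Long R b × Long R c × Long R d
      all-long = x-long⇒all-long x-long
      refute : Short R (b -ᵛ c) ⊎ Short R (b -ᵛ d) ⊎ Short R a ⊎ Short R b ⊎ Short R c ⊎ Short R d → ⊥
      refute (inj₁ x-short)                               = x-short x-long
      refute (inj₂ (inj₁ y-short))                        = y-short (proj₁ all-long)
      refute (inj₂ (inj₂ (inj₁ a-short)))                 = a-short (proj₁ (proj₂ all-long))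
      refute (inj₂ (inj₂ (inj₂ (inj₁ b-short))))          = b-short (proj₁ (proj₂ (proj₂ all-long)))
      refute (inj₂ (inj₂ (inj₂ (inj₂ (inj₁ c-short)))))   = c-short (proj₁ (proj₂ (proj₂ (proj₂ all-long))))
      refute (inj₂ (inj₂ (inj₂ (inj₂ (inj₂ d-short)))))   = d-short (proj₂ (proj₂ (proj₂ (proj₂ all-long))))

    y-long⇒x-long : Long R (b -ᵛ d) → Long R (b -ᵛ c)
    y-long⇒x-long = proj₁ ∘ ConfigNorms.x-long⇒all-long (swap-cd cfg)

    at-most-one-long : d ≢ c → Short R (b -ᵛ c) → Short R (b -ᵛ d) → AtMostOneLong R (a ∷ b ∷ c ∷ d ∷ [])
    at-most-one-long d≢c x-short y-short = pairwise
      where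
      d-a≡b-c : d -ᵛ a ≡ b -ᵛ c
      d-a≡b-c = a+b≡c+d⇒d-a≡b-c a b c d a+b≡c+d
      c-a≡b-d : c -ᵛ a ≡ b -ᵛ d
      c-a≡b-d = a+b≡c+d⇒d-a≡b-c a b d c (trans a+b≡c+d (+ᵛ-comm c d))
      ab : Long R a → Long R b → ⊥
      ab = ab-long⇒⊥ d≢c x-short y-short
      cd : Long R c → Long R d → ⊥
      cd = ConfigNorms.ab-long⇒⊥ (swap-pairs cfg (≢-sym d≢c)) (≢-sym a≢b)
             (x-short ∘ subst (Long R) d-a≡b-c)
             (y-short ∘ subst (Long R) (neg[v-u]≡u-v b d) ∘ Long-negᵛ {d -ᵛ b})
      ac-long : Long R a → Long R c → ⊥
      ac-long La Lc = y-short (subst (Long R) c-a≡b-d (long-pair⇒long-difference (Acute-sym ac) Lc La))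
      bd-long : Long R b → Long R d → ⊥
      bd-long Lb Ld = y-short (long-pair⇒long-difference bd Lb Ld)
      bc-long : Long R b → Long R c → ⊥
      bc-long Lb Lc = x-short (long-pair⇒long-difference bc Lb Lc)
      ad-long : Long R a → Long R d → ⊥
      ad-long La Ld = x-short (subst (Long R) d-a≡b-c (long-pair⇒long-difference da Ld La))
      pairwise : AtMostOneLong R (a ∷ b ∷ c ∷ d ∷ [])
      pairwise 0F 0F _ _ = refl
      pairwise 1F 1F _ _ = refl
      pairwise 2F 2F _ _ = refl
      pairwise 3F 3F _ _ = refl
      pairwise 0F 1F La Lb = ⊥-elim (ab La Lb)
      pairwise 1F 0F Lb La = ⊥-elim (ab La Lb)
      pairwise 2F 3F Lc Ld = ⊥-elim (cd Lc Ld)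
      pairwise 3F 2F Ld Lc = ⊥-elim (cd Lc Ld)
      pairwise 0F 2F La Lc = ⊥-elim (ac-long La Lc)
      pairwise 2F 0F Lc La = ⊥-elim (ac-long La Lc)
      pairwise 1F 3F Lb Ld = ⊥-elim (bd-long Lb Ld)
      pairwise 3F 1F Ld Lb = ⊥-elim (bd-long Lb Ld)
      pairwise 1F 2F Lb Lc = ⊥-elim (bc-long Lb Lc)
      pairwise 2F 1F Lc Lb = ⊥-elim (bc-long Lb Lc)
      pairwise 0F 3F La Ld = ⊥-elim (ad-long La Ld)
      pairwise 3F 0F Ld La = ⊥-elim (ad-long La Ld)

  module _ {a b c : Vecℤ n} (cfg : Config a b c c) where
    open Config cfg
    open ConfigBasics cfg
    open ConfigNorms cfg

    c-short : Short R c
    c-short c-long = ℤ.<⇒≱ (3x<4x (∥root∥²>0 c∈Φ)) (begin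
      + 4 * ∥ c ∥²                               ≡⟨ quadruple ∥ c ∥² ⟩
      ∥ c ∥² + + 2 * ∥ c ∥² + ∥ c ∥²               ≡⟨ norm-sum ⟨
      ∥ a ∥² + + 2 * ⟪ a , b ⟫ + ∥ b ∥²             ≤⟨ ℤ.+-mono-≤ (ℤ.+-mono-≤ (c-long a a∈Φ) 2⟪a,b⟫≤C) (c-long b b∈Φ) ⟩
      ∥ c ∥² + ∥ c ∥² + ∥ c ∥²                      ≡⟨ triple ∥ c ∥² ⟩
      + 3 * ∥ c ∥²                               ∎)
      where
      open ℤ.≤-Reasoning
      2⟪a,b⟫≤C : + 2 * ⟪ a , b ⟫ ≤ ∥ c ∥²
      2⟪a,b⟫≤C = 2⟪⟫≤ a∈Φ b∈Φ (≢-sym a≢b) (0≤⟪⟫ a∈I b∈I) (c-long a a∈Φ) (c-long b b∈Φ)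
      quadruple : ∀ C → + 4 * C ≡ C + + 2 * C + C
      quadruple = solve-∀
      triple : ∀ C → C + C + C ≡ + 3 * C
      triple = solve-∀

    ∥c∥²<∥a∥² : ∥ c ∥² < ∥ a ∥²
    ∥c∥²<∥a∥² with ∥ a ∥² ℤ.≤? ∥ c ∥²
    ... | no A≰C = ℤ.≰⇒> A≰C
    ... | yes A≤C = ⊥-elim (abelian a c a∈I c∈I (subst (_∈ Φ) (neg[neg[u]]≡u (a +ᵛ c)) (negᵛ∈Φ -[a+c]∈Φ)))
      where
      2⟪a,c⟫≡C : + 2 * ⟪ a , c ⟫ ≡ ∥ c ∥²
      2⟪a,c⟫≡C = AcuteNorms.≤⇒2w≡V (acute-norms ac) A≤C
      2⟪b,c⟫≡3C : + 2 * ⟪ b , c ⟫ ≡ + 3 * ∥ c ∥²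
      2⟪b,c⟫≡3C = begin
        + 2 * ⟪ b , c ⟫                               ≡⟨ isolate ⟪ a , c ⟫ ⟪ b , c ⟫ ⟩
        + 2 * (⟪ a , c ⟫ + ⟪ b , c ⟫) - + 2 * ⟪ a , c ⟫  ≡⟨ cong₂ (λ s t → + 2 * s - t) (pairing-sum c) 2⟪a,c⟫≡C ⟩
        + 2 * (∥ c ∥² + ∥ c ∥²) - ∥ c ∥²                 ≡⟨ collect ∥ c ∥² ⟩
        + 3 * ∥ c ∥²                                  ∎
        where
        open ≡-Reasoning
        isolate : ∀ x y → + 2 * y ≡ + 2 * (x + y) - + 2 * x
        isolate = solve-∀
        collect : ∀ C → + 2 * (C + C) - C ≡ + 3 * C
        collect = solve-∀
      -[a+c]∈Φ : negᵛ (a +ᵛ c) ∈ Φ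
      -[a+c]∈Φ = subst (_∈ Φ) (a+b≡c+c⇒b-[3·c]≡neg[a+c] a b c a+b≡c+d) (reflection∈Φ (+ 3) b∈Φ c∈Φ 2⟪b,c⟫≡3C)

    a-long : Long R a
    a-long = longer-root-is-long irreducible c∈Φ a∈Φ ∥c∥²<∥a∥²

  c≡d⇒c-short-a-b-long : ∀ {a b c d} → Config a b c d → c ≡ d → Short R c × Long R a × Long R b
  c≡d⇒c-short-a-b-long cfg refl = c-short cfg , a-long cfg , a-long (swap-ab cfg)

lemma4p7 : ∀ {n : ℕ} (R : RootSystem n) → Irreducible R →
    ∀ (I : Vecℤ n → Set) → AbelianIdeal R I →
    ∀ β₁ β₂ γ₁ γ₂ → I β₁ → I β₂ → I γ₁ → I γ₂ →
    β₁ +ᵛ β₂ ≡ γ₁ +ᵛ γ₂ →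
    _≺_ R β₁ γ₁ → _≺_ R γ₁ β₂ → _≺_ R β₁ γ₂ → _≺_ R γ₂ β₂ →
    (β₂ -ᵛ γ₁) ∈ RootSystem.Φ R × (β₂ -ᵛ γ₂) ∈ RootSystem.Φ R
    × (Long R (β₂ -ᵛ γ₁) →
        Long R (β₂ -ᵛ γ₂) × Long R β₁ × Long R β₂ × Long R γ₁ × Long R γ₂)
    × ((Short R (β₂ -ᵛ γ₁) ⊎ Short R (β₂ -ᵛ γ₂) ⊎ Short R β₁ ⊎ Short R β₂
          ⊎ Short R γ₁ ⊎ Short R γ₂) →
        Short R (β₂ -ᵛ γ₁) × Short R (β₂ -ᵛ γ₂)
        × (γ₁ ≢ γ₂ → AtMostOneLong R (β₁ ∷ β₂ ∷ γ₁ ∷ γ₂ ∷ []))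
        × (γ₁ ≡ γ₂ → Short R γ₁ × Long R β₁ × Long R β₂))
lemma4p7 R irreducible I ideal β₁ β₂ γ₁ γ₂ β₁∈I β₂∈I γ₁∈I γ₂∈I β₁+β₂≡γ₁+γ₂
         (β₁≼γ₁ , β₁≢γ₁) (γ₁≼β₂ , γ₁≢β₂) (_ , β₁≢γ₂) (_ , γ₂≢β₂) =
  b-c∈Φ cfg , b-c∈Φ (swap-cd cfg) , x-long⇒all-long cfg , λ some-short →
    let x-short = some-short⇒x-short cfg some-short
        y-short = x-short ∘ y-long⇒x-long cfg
    in x-short , y-short , (λ γ₁≢γ₂ → at-most-one-long cfg (≢-sym γ₁≢γ₂) x-short y-short)
     , c≡d⇒c-short-a-b-long cfg
  where
  open AbelianIdealQuadruples R irreducible I ideal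
  open ConfigBasics using (b-c∈Φ)
  open ConfigNorms using (x-long⇒all-long)
  β₁≢β₂ : β₁ ≢ β₂
  β₁≢β₂ refl = β₁≢γ₁ (nonneg-antisym β₁ γ₁ β₁≼γ₁ γ₁≼β₂)
  cfg : Config β₁ β₂ γ₁ γ₂
  cfg = record { a∈I = β₁∈I ; b∈I = β₂∈I ; c∈I = γ₁∈I ; d∈I = γ₂∈I ; a+b≡c+d = β₁+β₂≡γ₁+γ₂
               ; a≢c = β₁≢γ₁ ; c≢b = γ₁≢β₂ ; a≢d = β₁≢γ₂ ; d≢b = γ₂≢β₂ ; a≢b = β₁≢β₂ }
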